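{- Suppose there is an $(n,m;k_1,\dots,k_m;\lambda_1,\dots,\lambda_m)$-generalized strong external difference family in an additive abelian group $\mathcal{G}$ of order $n$, and let $a=\sum_{i=1}^m k_i$. Then there is a weak AMD code with $m$ sources over $\mathcal{G}$ with total number of valid encodings $a$ and with $\hat\epsilon=\frac{a(m-1)}{m(n-1)}$ (i.e. an R-optimal weak AMD code).
   Context: For disjoint subsets $A,B$ of $\mathcal{G}$, $\mathcal{D}(A,B)$ denotes the multiset $\{x-y : x\in A, y\in B\}$. An $(n,m;k_1,\dots,k_m;\lambda_1,\dots,\lambda_m)$-GSEDF is a collection of $m$ pairwise disjoint subsets $A_1,\dots,A_m$ of $\mathcal{G}$ with $|A_i|=k_i$ such that for every $i$, $\bigcup_{j\ne i}\mathcal{D}(A_i,A_j)=\lambda_i(\mathcal{G}\setminus\{0\})$ as multisets. An AMD code over $\mathcal{G}$ (with $n\ge2$) with source set $\mathcal{S}$, $|\mathcal{S}|=m$, consists of pairwise disjoint nonempty subsets $A(s)\subseteq\mathcal{G}$ and a (possibly randomized) public encoding function $E$ mapping $s$ to some $g\in A(s)$ with probability $\Pr[E(s)=g]$; its total number of valid encodings is $a=\sum_s|A(s)|$. Weak security game: the adversary chooses $\Delta\in\mathcal{G}\setminus\{0\}$ by a (possibly randomized) strategy $\sigma$; then $s$ is chosen uniformly from $\mathcal{S}$ and encoded as $g=E(s)$; the adversary wins iff $g+\Delta\in A(s')$ for some $s'\ne s$. $\hat\epsilon$ is the maximum winning probability over all strategies. -}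

module Defs where

open import Data.Nat as ℕ using (ℕ; zero; suc; _∸_)
open import Data.Integer using (+_)
open import Data.Rational as ℚ using (ℚ; 0ℚ; 1ℚ; _≤_)
open import Data.Fin using (Fin; zero; suc)
open import Data.Fin.Subset using (Subset; _∈_; ∣_∣; Nonempty; _∩_; Empty)
open import Data.Vec using (lookup)
open import Data.Bool using (Bool; true; false; if_then_else_; _∧_; _∨_; not)
open import Relation.Nullary.Decidable using (⌊_⌋)
open import Relation.Binary.PropositionalEquality using (_≡_)
import Algebra.Structures as AS
open import Data.Product using (Σ; _×_)
open import Relation.Nullary using (¬_)
import Data.Fin as F

-- An additive abelian group of order n, with carrier represented as Fin n
-- (every finite abelian group of order n is isomorphic to such a structure).
record FinAbGroup (n : ℕ) : Set where
  field
    _⊕_ : Fin n → Fin n → Fin n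
    𝟘 : Fin n
    ⊖_ : Fin n → Fin n
    isAbelianGroup : AS.IsAbelianGroup (_≡_ {A = Fin n}) _⊕_ 𝟘 ⊖_

  _⊝_ : Fin n → Fin n → Fin n
  x ⊝ y = x ⊕ (⊖ y)

sumℕ : ∀ {k} → (Fin k → ℕ) → ℕ
sumℕ {zero} f = 0
sumℕ {suc k} f = f zero ℕ.+ sumℕ (λ i → f (suc i))

sumℚ : ∀ {k} → (Fin k → ℚ) → ℚ
sumℚ {zero} f = 0ℚ
sumℚ {suc k} f = f zero ℚ.+ sumℚ (λ i → f (suc i))

anyB : ∀ {k} → (Fin k → Bool) → Bool
anyB {zero} f = false
anyB {suc k} f = f zero ∨ anyB (λ i → f (suc i))

ind : Bool → ℕ
ind true = 1
ind false = 0

indℚ : Bool → ℚ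
indℚ true = 1ℚ
indℚ false = 0ℚ

_≠ᵇ_ : ∀ {k} → Fin k → Fin k → Bool
i ≠ᵇ j = not ⌊ i F.≟ j ⌋

_≡ᵇ_ : ∀ {k} → Fin k → Fin k → Bool
i ≡ᵇ j = ⌊ i F.≟ j ⌋

-- p / q as a rational (q = 0 never occurs under the theorem's hypotheses)
ratio : ℕ → ℕ → ℚ
ratio p zero = 0ℚ
ratio p (suc q) = (+ p) ℚ./ suc q

module _ {n : ℕ} (G : FinAbGroup n) where
  open FinAbGroup G

  -- multiplicity of g in the multiset D(A,B) = {x - y : x ∈ A, y ∈ B}
  multD : Subset n → Subset n → Fin n → ℕ
  multD A B g = sumℕ (λ x → sumℕ (λ y →
    ind (lookup A x ∧ lookup B y ∧ ((x ⊝ y) ≡ᵇ g))))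

  record IsGSEDF (m : ℕ) (k : Fin m → ℕ) (λs : Fin m → ℕ)
                 (A : Fin m → Subset n) : Set where
    field
      disjoint : ∀ i j → ¬ i ≡ j → Empty (A i ∩ A j)
      sizes    : ∀ i → ∣ A i ∣ ≡ k i
      -- multiplicity of each g in ⋃_{j≠i} D(A_i,A_j) equals that in λ_i(G∖{0})
      diffs    : ∀ i g →
        sumℕ (λ j → if i ≠ᵇ j then multD (A i) (A j) g else 0)
          ≡ (if g ≡ᵇ 𝟘 then 0 else λs i)

  -- An AMD code over G with source set Fin m: valid-encoding sets A(s) and a
  -- randomized encoding E, where E s g = Pr[E(s) = g].
  record AMDCode (m : ℕ) : Set where
    field
      A : Fin m → Subset n
      E : Fin m → Fin n → ℚ
      disjoint : ∀ s t → ¬ s ≡ t → Empty (A s ∩ A t)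
      nonempty : ∀ s → Nonempty (A s)
      E-nonneg : ∀ s g → 0ℚ ≤ E s g
      E-support : ∀ s g → ¬ (g ∈ A s) → E s g ≡ 0ℚ
      E-sum : ∀ s → sumℚ (E s) ≡ 1ℚ

  module _ {m : ℕ} (C : AMDCode m) where
    open AMDCode C

    totalEncodings : ℕ
    totalEncodings = sumℕ (λ s → ∣ A s ∣)

    record Strategy : Set where
      field
        σ : Fin n → ℚ
        σ-nonneg : ∀ Δ → 0ℚ ≤ σ Δ
        σ-zero : σ 𝟘 ≡ 0ℚ
        σ-sum : sumℚ σ ≡ 1ℚ

    wins : Fin m → Fin n → Fin n → Bool
    wins s g Δ = anyB (λ s' → (s' ≠ᵇ s) ∧ lookup (A s') (g ⊕ Δ))

    -- winning probability in the weak game (s uniform on the m sources)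
    winProb : Strategy → ℚ
    winProb st = sumℚ (λ Δ → Strategy.σ st Δ ℚ.* sumℚ (λ s →
      ratio 1 m ℚ.* sumℚ (λ g → E s g ℚ.* indℚ (wins s g Δ))))

    IsMaxWinProb : ℚ → Set
    IsMaxWinProb ε = (∀ st → winProb st ≤ ε) × Σ Strategy (λ st → winProb st ≡ ε)

-- Take the sets of the difference family as the encoding sets and encode every
-- source uniformly. For a source s and a shift Δ ≠ 0, the encodings g ∈ A_s with
-- g + Δ in some other A_j are exactly the pairs (g, g + Δ) counted by the
-- multiplicity of -Δ in ⋃_{j≠s} D(A_s, A_j), i.e. there are λ_s of them. Hence
-- every shift Δ ≠ 0 succeeds with the same probability (1/m) Σ_s λ_s / k_s, so
-- every strategy wins with that probability. Counting all differences of A_s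
-- gives k_s (a - k_s) = λ_s (n - 1), which turns the sum into a (m - 1) / (m (n - 1)).
module Submission where

open import Defs
open import Algebra.Bundles using (AbelianGroup)
import Algebra.Properties.AbelianGroup as AbelianGroupProperties
import Algebra.Properties.CommutativeSemigroup as CommutativeSemigroupProperties
open import Data.Bool using (Bool; true; false; _∧_; _∨_; not; if_then_else_)
open import Data.Bool.Properties using (∧-zeroʳ; ∧-identityʳ; ∧-distribˡ-∨; if-not)
open import Data.Empty using (⊥-elim)
open import Data.Fin using (Fin; zero; suc; punchIn)
import Data.Fin as Fin
open import Data.Fin.Properties using (suc-injective; punchInᵢ≢i; 0≢1+n)
open import Data.Fin.Subset using (Subset; _∉_; ∣_∣; Nonempty)
open import Data.Fin.Subset.Properties using (x∈p∩q⁺; nonempty?; Empty-unique; ∣⊥∣≡0)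
import Data.Integer as ℤ
import Data.Integer.Properties as ℤ
open import Data.Integer.Tactic.RingSolver using (solve-∀)
open import Data.Nat using (ℕ; zero; suc; _+_; _*_; _∸_; _≤_; z≤n; s≤s)
open import Data.Nat.Properties
  using (+-comm; +-identityʳ; +-cancelʳ-≡; +-commutativeSemigroup; *-comm; *-zeroʳ;
         *-identityˡ; *-distribˡ-+; *-mono-≤; ∸-monoˡ-≤; n>0⇒n≢0)
open import Data.Product using (Σ; ∃; _×_; _,_)
open import Data.Rational using (ℚ; 0ℚ; 1ℚ)
import Data.Rational as ℚ
import Data.Rational.Properties as ℚ
open import Data.Rational.Unnormalised using (ℚᵘ; mkℚᵘ; *≡*)
import Data.Rational.Unnormalised as ℚᵘ
import Data.Rational.Unnormalised.Properties as ℚᵘ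
open import Data.Vec using ([]; _∷_; lookup)
open import Data.Vec.Properties using (lookup⇒[]=)
open import Function using (_∘_)
open import Level using (0ℓ)
open import Relation.Binary.PropositionalEquality
open import Relation.Nullary using (yes; no)

open CommutativeSemigroupProperties +-commutativeSemigroup using (interchange)

sumℕ-cong : ∀ {k} {f g : Fin k → ℕ} → (∀ i → f i ≡ g i) → sumℕ f ≡ sumℕ g
sumℕ-cong {zero}  f≗g = refl
sumℕ-cong {suc k} f≗g = cong₂ _+_ (f≗g zero) (sumℕ-cong (f≗g ∘ suc))

sumℕ-zero : ∀ k → sumℕ {k} (λ _ → 0) ≡ 0
sumℕ-zero zero    = refl
sumℕ-zero (suc k) = sumℕ-zero k

sumℕ-const : ∀ k c → sumℕ {k} (λ _ → c) ≡ k * c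
sumℕ-const zero    c = refl
sumℕ-const (suc k) c = cong (c +_) (sumℕ-const k c)

sumℕ-distrib-+ : ∀ {k} (f g : Fin k → ℕ) → sumℕ (λ i → f i + g i) ≡ sumℕ f + sumℕ g
sumℕ-distrib-+ {zero}  f g = refl
sumℕ-distrib-+ {suc k} f g =
  trans (cong (f zero + g zero +_) (sumℕ-distrib-+ (f ∘ suc) (g ∘ suc)))
        (interchange (f zero) (g zero) (sumℕ (f ∘ suc)) (sumℕ (g ∘ suc)))

sumℕ-comm : ∀ {k l} (f : Fin k → Fin l → ℕ) →
            sumℕ (λ i → sumℕ (f i)) ≡ sumℕ (λ j → sumℕ (λ i → f i j))
sumℕ-comm {zero}  {l} f = sym (sumℕ-zero l)
sumℕ-comm {suc k}     f =
  trans (cong (sumℕ (f zero) +_) (sumℕ-comm (f ∘ suc)))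
        (sym (sumℕ-distrib-+ (f zero) (λ j → sumℕ (λ i → f (suc i) j))))

*-distribˡ-sumℕ : ∀ {k} c (f : Fin k → ℕ) → c * sumℕ f ≡ sumℕ (λ i → c * f i)
*-distribˡ-sumℕ {zero}  c f = *-zeroʳ c
*-distribˡ-sumℕ {suc k} c f =
  trans (*-distribˡ-+ c (f zero) _) (cong (c * f zero +_) (*-distribˡ-sumℕ c (f ∘ suc)))

*-distribʳ-sumℕ : ∀ {k} c (f : Fin k → ℕ) → sumℕ f * c ≡ sumℕ (λ i → f i * c)
*-distribʳ-sumℕ c f =
  trans (*-comm _ c) (trans (*-distribˡ-sumℕ c f) (sumℕ-cong (λ i → *-comm c (f i))))

sumℕ-single : ∀ {k} (f : Fin k → ℕ) i → (∀ j → j ≢ i → f j ≡ 0) → sumℕ f ≡ f i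
sumℕ-single {suc k} f zero    others =
  trans (cong (f zero +_) (trans (sumℕ-cong (λ j → others (suc j) (0≢1+n ∘ sym))) (sumℕ-zero k)))
        (+-identityʳ (f zero))
sumℕ-single {suc k} f (suc i) others =
  trans (cong (_+ sumℕ (f ∘ suc)) (others zero 0≢1+n))
        (sumℕ-single (f ∘ suc) i (λ j j≢i → others (suc j) (j≢i ∘ suc-injective)))

≡ᵇ-true : ∀ {k} {i j : Fin k} → i ≡ j → (i ≡ᵇ j) ≡ true
≡ᵇ-true {i = i} {j} i≡j with i Fin.≟ j
... | yes _   = refl
... | no  i≢j = ⊥-elim (i≢j i≡j)

≡ᵇ-false : ∀ {k} {i j : Fin k} → i ≢ j → (i ≡ᵇ j) ≡ false
≡ᵇ-false {i = i} {j} i≢j with i Fin.≟ j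
... | yes i≡j = ⊥-elim (i≢j i≡j)
... | no  _   = refl

≠ᵇ-sym : ∀ {k} (i j : Fin k) → (i ≠ᵇ j) ≡ (j ≠ᵇ i)
≠ᵇ-sym i j with i Fin.≟ j
... | yes i≡j = cong not (sym (≡ᵇ-true (sym i≡j)))
... | no  i≢j = cong not (sym (≡ᵇ-false (i≢j ∘ sym)))

sumℕ-indicator : ∀ {k} (z : Fin k) c → sumℕ (λ i → if i ≡ᵇ z then c else 0) ≡ c
sumℕ-indicator z c =
  trans (sumℕ-single _ z (λ j j≢z → cong (λ b → if b then c else 0) (≡ᵇ-false j≢z)))
        (cong (λ b → if b then c else 0) (≡ᵇ-true {i = z} refl))

sumℕ-punctured : ∀ {k} (z : Fin k) c → sumℕ (λ i → if i ≡ᵇ z then 0 else c) ≡ (k ∸ 1) * c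
sumℕ-punctured {suc k} z c = +-cancelʳ-≡ c _ _ (begin
  sumℕ outside + c                          ≡⟨ cong (sumℕ outside +_) (sym (sumℕ-indicator z c)) ⟩
  sumℕ outside + sumℕ inside                ≡⟨ sym (sumℕ-distrib-+ outside inside) ⟩
  sumℕ (λ i → outside i + inside i)         ≡⟨ sumℕ-cong (λ i → split (i ≡ᵇ z)) ⟩
  sumℕ {suc k} (λ _ → c)                    ≡⟨ sumℕ-const (suc k) c ⟩
  c + k * c                                 ≡⟨ +-comm c (k * c) ⟩
  k * c + c                                 ∎)
  where
  open ≡-Reasoning
  outside inside : Fin (suc k) → ℕ
  outside i = if i ≡ᵇ z then 0 else c
  inside  i = if i ≡ᵇ z then c else 0
  split : ∀ b → (if b then 0 else c) + (if b then c else 0) ≡ c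
  split true  = refl
  split false = +-identityʳ c

ind-∧ : ∀ a b → ind (a ∧ b) ≡ ind a * ind b
ind-∧ true  true  = refl
ind-∧ true  false = refl
ind-∧ false b     = refl

∧-anyB : ∀ {k} a (f : Fin k → Bool) → a ∧ anyB f ≡ anyB (λ i → a ∧ f i)
∧-anyB {zero}  a f = ∧-zeroʳ a
∧-anyB {suc k} a f = trans (∧-distribˡ-∨ a (f zero) _) (cong (a ∧ f zero ∨_) (∧-anyB a (f ∘ suc)))

ind-anyB : ∀ {k} (f : Fin k → Bool) → (∀ i j → f i ≡ true → f j ≡ true → i ≡ j) →
           ind (anyB f) ≡ sumℕ (λ i → ind (f i))
ind-anyB {zero}  f unique = refl
ind-anyB {suc k} f unique with f zero in f₀
... | true  = cong suc (sym (trans (sumℕ-cong (cong ind ∘ rest-false)) (sumℕ-zero k)))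
  where
  rest-false : ∀ i → f (suc i) ≡ false
  rest-false i with f (suc i) in fᵢ
  ... | true  = ⊥-elim (0≢1+n (unique zero (suc i) f₀ fᵢ))
  ... | false = refl
... | false = ind-anyB (f ∘ suc) (λ i j fᵢ fⱼ → suc-injective (unique (suc i) (suc j) fᵢ fⱼ))

∧∧-true⇒true : ∀ a b c → a ∧ b ∧ c ≡ true → c ≡ true
∧∧-true⇒true true  true  c eq = eq
∧∧-true⇒true true  false c ()
∧∧-true⇒true false b     c ()

sumℕ-select : ∀ {k} a (b e : Fin k → Bool) i → e i ≡ true → (∀ j → j ≢ i → e j ≡ false) →
              sumℕ (λ j → ind (a ∧ b j ∧ e j)) ≡ ind (a ∧ b i)
sumℕ-select a b e i eᵢ others =
  trans (sumℕ-single _ i (λ j j≢i → trans (cong (λ t → ind (a ∧ b j ∧ t)) (others j j≢i))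
                                          (cong ind (trans (cong (a ∧_) (∧-zeroʳ (b j))) (∧-zeroʳ a)))))
        (trans (cong (λ t → ind (a ∧ b i ∧ t)) eᵢ) (cong (λ t → ind (a ∧ t)) (∧-identityʳ (b i))))

∣p∣≡sumℕ-ind : ∀ {k} (p : Subset k) → ∣ p ∣ ≡ sumℕ (λ x → ind (lookup p x))
∣p∣≡sumℕ-ind []          = refl
∣p∣≡sumℕ-ind (true  ∷ p) = cong suc (∣p∣≡sumℕ-ind p)
∣p∣≡sumℕ-ind (false ∷ p) = ∣p∣≡sumℕ-ind p

∣p∣≥1⇒Nonempty : ∀ {k} (p : Subset k) → 1 ≤ ∣ p ∣ → Nonempty p
∣p∣≥1⇒Nonempty {k} p ∣p∣≥1 with nonempty? p
... | yes nonempty = nonempty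
... | no  empty    = ⊥-elim (n>0⇒n≢0 ∣p∣≥1 (trans (cong ∣_∣ (Empty-unique empty)) (∣⊥∣≡0 k)))

∉⇒lookup≡false : ∀ {k} {x : Fin k} {p : Subset k} → x ∉ p → lookup p x ≡ false
∉⇒lookup≡false {x = x} {p} x∉p with lookup p x in pₓ
... | true  = ⊥-elim (x∉p (lookup⇒[]= x p pₓ))
... | false = refl

-- `ratio p (suc d)` is definitionally `ℚ.fromℚᵘ (mkℚᵘ (+ p) d)`, so its arithmetic is done in ℚᵘ.
fromℚᵘ-homo : {_∙_ : ℚ → ℚ → ℚ} {_∘ᵘ_ : ℚᵘ → ℚᵘ → ℚᵘ} →
              (∀ p q → ℚ.toℚᵘ (p ∙ q) ℚᵘ.≃ ℚ.toℚᵘ p ∘ᵘ ℚ.toℚᵘ q) →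
              (∀ {x y u v} → x ℚᵘ.≃ y → u ℚᵘ.≃ v → x ∘ᵘ u ℚᵘ.≃ y ∘ᵘ v) →
              ∀ x y → ℚ.fromℚᵘ (x ∘ᵘ y) ≡ ℚ.fromℚᵘ x ∙ ℚ.fromℚᵘ y
fromℚᵘ-homo homo ∘ᵘ-cong x y = ℚ.toℚᵘ-injective
  (ℚᵘ.≃-trans (ℚ.toℚᵘ-fromℚᵘ _)
  (ℚᵘ.≃-trans (∘ᵘ-cong (ℚᵘ.≃-sym (ℚ.toℚᵘ-fromℚᵘ x)) (ℚᵘ.≃-sym (ℚ.toℚᵘ-fromℚᵘ y)))
              (ℚᵘ.≃-sym (homo _ _))))

ratio-cong : ∀ {a b d e} → 1 ≤ d → 1 ≤ e → a * e ≡ b * d → ratio a d ≡ ratio b e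
ratio-cong {a} {b} {suc d} {suc e} (s≤s z≤n) (s≤s z≤n) ae≡bd =
  ℚ.fromℚᵘ-cong {mkℚᵘ (ℤ.+ a) d} {mkℚᵘ (ℤ.+ b) e}
    (*≡* (trans (sym (ℤ.pos-* a (suc e))) (trans (cong ℤ.+_ ae≡bd) (ℤ.pos-* b (suc d)))))

ratio-zero : ∀ {d} → 1 ≤ d → ratio 0 d ≡ 0ℚ
ratio-zero {suc d} (s≤s z≤n) = ℚ.0/n≡0 (suc d)

ratio-self : ∀ {d} → 1 ≤ d → ratio d d ≡ 1ℚ
ratio-self {d} d≥1 = ratio-cong {d} {1} d≥1 (s≤s z≤n) (*-comm d 1)

ratio-nonneg : ∀ p {d} → 1 ≤ d → 0ℚ ℚ.≤ ratio p d
ratio-nonneg p {suc d} (s≤s z≤n) = ℚ.nonNegative⁻¹ _ {{ℚ.normalize-nonNeg p (suc d)}}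

ratio-+ : ∀ a b {d} → 1 ≤ d → ratio a d ℚ.+ ratio b d ≡ ratio (a + b) d
ratio-+ a b {suc d} (s≤s z≤n) =
  trans (sym (fromℚᵘ-homo ℚ.toℚᵘ-homo-+ ℚᵘ.+-cong (mkℚᵘ (ℤ.+ a) d) (mkℚᵘ (ℤ.+ b) d)))
        (ℚ.fromℚᵘ-cong {mkℚᵘ (ℤ.+ a) d ℚᵘ.+ mkℚᵘ (ℤ.+ b) d} {mkℚᵘ (ℤ.+ (a + b)) d}
          (*≡* (trans (common-denominator (ℤ.+ a) (ℤ.+ b) (ℤ.+ suc d))
                      (sym (cong₂ ℤ._*_ (ℤ.pos-+ a b) (ℤ.pos-* (suc d) (suc d)))))))
  where
  common-denominator : ∀ x y z → (x ℤ.* z ℤ.+ y ℤ.* z) ℤ.* z ≡ (x ℤ.+ y) ℤ.* (z ℤ.* z)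
  common-denominator = solve-∀

ratio-* : ∀ a b {d e} → 1 ≤ d → 1 ≤ e → ratio a d ℚ.* ratio b e ≡ ratio (a * b) (d * e)
ratio-* a b {suc d} {suc e} (s≤s z≤n) (s≤s z≤n) =
  trans (sym (fromℚᵘ-homo ℚ.toℚᵘ-homo-* ℚᵘ.*-cong (mkℚᵘ (ℤ.+ a) d) (mkℚᵘ (ℤ.+ b) e)))
        (cong (λ z → ℚ.fromℚᵘ (mkℚᵘ z (e + d * suc e))) (sym (ℤ.pos-* a b)))

ratio-ind-*-indℚ : ∀ a b {d} → 1 ≤ d → ratio (ind a) d ℚ.* indℚ b ≡ ratio (ind (a ∧ b)) d
ratio-ind-*-indℚ a true  {d} d≥1 =
  trans (ℚ.*-identityʳ (ratio (ind a) d)) (cong (λ t → ratio (ind t) d) (sym (∧-identityʳ a)))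
ratio-ind-*-indℚ a false {d} d≥1 =
  trans (ℚ.*-zeroʳ (ratio (ind a) d))
        (trans (sym (ratio-zero d≥1)) (cong (λ t → ratio (ind t) d) (sym (∧-zeroʳ a))))

sumℚ-cong : ∀ {k} {f g : Fin k → ℚ} → (∀ i → f i ≡ g i) → sumℚ f ≡ sumℚ g
sumℚ-cong {zero}  f≗g = refl
sumℚ-cong {suc k} f≗g = cong₂ ℚ._+_ (f≗g zero) (sumℚ-cong (f≗g ∘ suc))

*-distribʳ-sumℚ : ∀ {k} c (f : Fin k → ℚ) → sumℚ f ℚ.* c ≡ sumℚ (λ i → f i ℚ.* c)
*-distribʳ-sumℚ {zero}  c f = ℚ.*-zeroˡ c
*-distribʳ-sumℚ {suc k} c f =
  trans (ℚ.*-distribʳ-+ c (f zero) _) (cong (f zero ℚ.* c ℚ.+_) (*-distribʳ-sumℚ c (f ∘ suc)))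

sumℚ-ratio : ∀ {k} (f : Fin k → ℕ) {d} → 1 ≤ d → sumℚ (λ i → ratio (f i) d) ≡ ratio (sumℕ f) d
sumℚ-ratio {zero}  f d≥1 = sym (ratio-zero d≥1)
sumℚ-ratio {suc k} f {d} d≥1 =
  trans (cong (ratio (f zero) d ℚ.+_) (sumℚ-ratio (f ∘ suc) d≥1)) (ratio-+ (f zero) _ d≥1)

module _ {n : ℕ} (G : FinAbGroup n) where
  open FinAbGroup G

  private
    abelianGroup : AbelianGroup 0ℓ 0ℓ
    abelianGroup = record
      { Carrier = Fin n ; _≈_ = _≡_ ; _∙_ = _⊕_ ; ε = 𝟘 ; _⁻¹ = ⊖_ ; isAbelianGroup = isAbelianGroup }

  open AbelianGroupProperties abelianGroup
    using (⁻¹-anti-homo‿-; ⁻¹-involutive; ⁻¹-injective; ε⁻¹≈ε; //-rightDividesˡ; //-rightDividesʳ)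
  open AbelianGroup abelianGroup using (comm)

  ⊝-⊕ : ∀ x Δ → x ⊝ (x ⊕ Δ) ≡ ⊖ Δ
  ⊝-⊕ x Δ = begin
    x ⊝ (x ⊕ Δ)           ≡⟨ sym (⁻¹-involutive _) ⟩
    ⊖ (⊖ (x ⊝ (x ⊕ Δ)))   ≡⟨ cong ⊖_ (⁻¹-anti-homo‿- x (x ⊕ Δ)) ⟩
    ⊖ ((x ⊕ Δ) ⊝ x)       ≡⟨ cong (λ y → ⊖ (y ⊝ x)) (comm x Δ) ⟩
    ⊖ ((Δ ⊕ x) ⊝ x)       ≡⟨ cong ⊖_ (//-rightDividesʳ x Δ) ⟩
    ⊖ Δ                   ∎
    where open ≡-Reasoning

  ⊝≡⊖⇒≡⊕ : ∀ {x y Δ} → x ⊝ y ≡ ⊖ Δ → y ≡ x ⊕ Δ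
  ⊝≡⊖⇒≡⊕ {x} {y} {Δ} x⊝y≡⊖Δ = begin
    y                 ≡⟨ sym (//-rightDividesˡ x y) ⟩
    (y ⊝ x) ⊕ x       ≡⟨ cong (_⊕ x) (sym (⁻¹-anti-homo‿- x y)) ⟩
    (⊖ (x ⊝ y)) ⊕ x   ≡⟨ cong (λ z → (⊖ z) ⊕ x) x⊝y≡⊖Δ ⟩
    (⊖ (⊖ Δ)) ⊕ x     ≡⟨ cong (_⊕ x) (⁻¹-involutive Δ) ⟩
    Δ ⊕ x             ≡⟨ comm Δ x ⟩
    x ⊕ Δ             ∎
    where open ≡-Reasoning

  ⊖≡𝟘⇒≡𝟘 : ∀ {Δ} → ⊖ Δ ≡ 𝟘 → Δ ≡ 𝟘
  ⊖≡𝟘⇒≡𝟘 ⊖Δ≡𝟘 = ⁻¹-injective (trans ⊖Δ≡𝟘 (sym ε⁻¹≈ε))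

  nonzero-element : 2 ≤ n → ∃ λ δ → δ ≢ 𝟘
  nonzero-element (s≤s (s≤s z≤n)) = punchIn 𝟘 zero , punchInᵢ≢i 𝟘 zero

  multD-translate : ∀ B C Δ → multD G B C (⊖ Δ) ≡ sumℕ (λ x → ind (lookup B x ∧ lookup C (x ⊕ Δ)))
  multD-translate B C Δ = sumℕ-cong λ x →
    sumℕ-select (lookup B x) (lookup C) (λ y → (x ⊝ y) ≡ᵇ (⊖ Δ)) (x ⊕ Δ)
      (≡ᵇ-true (⊝-⊕ x Δ)) (λ y y≢x⊕Δ → ≡ᵇ-false (y≢x⊕Δ ∘ ⊝≡⊖⇒≡⊕))

  multD-translate-if : ∀ b B C Δ → sumℕ (λ x → ind (lookup B x ∧ b ∧ lookup C (x ⊕ Δ)))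
                                   ≡ (if b then multD G B C (⊖ Δ) else 0)
  multD-translate-if true  B C Δ = sym (multD-translate B C Δ)
  multD-translate-if false B C Δ = trans (sumℕ-cong (cong ind ∘ ∧-zeroʳ ∘ lookup B)) (sumℕ-zero n)

  multD-total : ∀ B C → sumℕ (multD G B C) ≡ ∣ B ∣ * ∣ C ∣
  multD-total B C = begin
    sumℕ (λ g → sumℕ (λ x → sumℕ (λ y → t x y g)))
      ≡⟨ sumℕ-comm (λ g x → sumℕ (λ y → t x y g)) ⟩
    sumℕ (λ x → sumℕ (λ g → sumℕ (λ y → t x y g)))
      ≡⟨ sumℕ-cong (λ x → sumℕ-comm (λ g y → t x y g)) ⟩
    sumℕ (λ x → sumℕ (λ y → sumℕ (t x y)))
      ≡⟨ sumℕ-cong (λ x → sumℕ-cong (λ y → sumℕ-select (lookup B x) (λ _ → lookup C y)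
           ((x ⊝ y) ≡ᵇ_) (x ⊝ y) (≡ᵇ-true refl) (λ g g≢x⊝y → ≡ᵇ-false (g≢x⊝y ∘ sym)))) ⟩
    sumℕ (λ x → sumℕ (λ y → ind (lookup B x ∧ lookup C y)))
      ≡⟨ sumℕ-cong (λ x → trans (sumℕ-cong (ind-∧ (lookup B x) ∘ lookup C))
                                (sym (*-distribˡ-sumℕ (ind (lookup B x)) (ind ∘ lookup C)))) ⟩
    sumℕ (λ x → ind (lookup B x) * sumℕ (λ y → ind (lookup C y)))
      ≡⟨ sym (*-distribʳ-sumℕ _ (ind ∘ lookup B)) ⟩
    sumℕ (λ x → ind (lookup B x)) * sumℕ (λ y → ind (lookup C y))
      ≡⟨ sym (cong₂ _*_ (∣p∣≡sumℕ-ind B) (∣p∣≡sumℕ-ind C)) ⟩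
    ∣ B ∣ * ∣ C ∣ ∎
    where
    open ≡-Reasoning
    t : Fin n → Fin n → Fin n → ℕ
    t x y g = ind (lookup B x ∧ lookup C y ∧ ((x ⊝ y) ≡ᵇ g))

  module _ {m : ℕ} (C : AMDCode G m) where
    open AMDCode C

    winProbAt : Fin n → ℚ
    winProbAt Δ = sumℚ (λ s → ratio 1 m ℚ.* sumℚ (λ g → E s g ℚ.* indℚ (wins G C s g Δ)))

    winProb-constant : ∀ {c} → (∀ Δ → Δ ≢ 𝟘 → winProbAt Δ ≡ c) → ∀ st → winProb G C st ≡ c
    winProb-constant {c} atΔ st = begin
      sumℚ (λ Δ → σ Δ ℚ.* winProbAt Δ) ≡⟨ sumℚ-cong σ*atΔ ⟩
      sumℚ (λ Δ → σ Δ ℚ.* c)           ≡⟨ sym (*-distribʳ-sumℚ c σ) ⟩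
      sumℚ σ ℚ.* c                     ≡⟨ cong (ℚ._* c) σ-sum ⟩
      1ℚ ℚ.* c                         ≡⟨ ℚ.*-identityˡ c ⟩
      c                                ∎
      where
      open ≡-Reasoning
      open Strategy st
      σ*atΔ : ∀ Δ → σ Δ ℚ.* winProbAt Δ ≡ σ Δ ℚ.* c
      σ*atΔ Δ with Δ Fin.≟ 𝟘
      ... | yes refl rewrite σ-zero = trans (ℚ.*-zeroˡ (winProbAt 𝟘)) (sym (ℚ.*-zeroˡ c))
      ... | no  Δ≢𝟘 = cong (σ Δ ℚ.*_) (atΔ Δ Δ≢𝟘)

    pointStrategy : ∀ δ → δ ≢ 𝟘 → Strategy G C
    pointStrategy δ δ≢𝟘 = record
      { σ        = λ Δ → ratio (point Δ) 1
      ; σ-nonneg = λ Δ → ratio-nonneg (point Δ) (s≤s z≤n)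
      ; σ-zero   = cong (λ b → ratio (if b then 1 else 0) 1) (≡ᵇ-false (δ≢𝟘 ∘ sym))
      ; σ-sum    = trans (sumℚ-ratio point (s≤s z≤n)) (cong (λ z → ratio z 1) (sumℕ-indicator δ 1))
      }
      where
      point : Fin n → ℕ
      point Δ = if Δ ≡ᵇ δ then 1 else 0

    constant⇒IsMaxWinProb : 2 ≤ n → ∀ {c} → (∀ Δ → Δ ≢ 𝟘 → winProbAt Δ ≡ c) → IsMaxWinProb G C c
    constant⇒IsMaxWinProb n≥2 atΔ =
      (λ st → ℚ.≤-reflexive (winProb-constant atΔ st)) ,
      (strategy , winProb-constant atΔ strategy)
      where
      strategy : Strategy G C
      strategy = let (δ , δ≢𝟘) = nonzero-element n≥2 in pointStrategy δ δ≢𝟘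

  module UniformCode {m} {k λs : Fin m → ℕ} (k≥1 : ∀ i → 1 ≤ k i) {A : Fin m → Subset n}
                     (gsedf : IsGSEDF G m k λs A) where
    open IsGSEDF gsedf

    sizeIfOther : Fin m → Fin m → ℕ
    sizeIfOther i j = if i ≠ᵇ j then k j else 0

    otherSizes : Fin m → ℕ
    otherSizes i = sumℕ (sizeIfOther i)

    size*otherSizes : ∀ i → k i * otherSizes i ≡ (n ∸ 1) * λs i
    size*otherSizes i = begin
      k i * otherSizes i                        ≡⟨ *-distribˡ-sumℕ (k i) (sizeIfOther i) ⟩
      sumℕ (λ j → k i * sizeIfOther i j)        ≡⟨ sumℕ-cong (λ j → pairs (i ≠ᵇ j) j) ⟩
      sumℕ (λ j → sumℕ (D j))                   ≡⟨ sumℕ-comm D ⟩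
      sumℕ (λ g → sumℕ (λ j → D j g))           ≡⟨ sumℕ-cong (diffs i) ⟩
      sumℕ (λ g → if g ≡ᵇ 𝟘 then 0 else λs i)   ≡⟨ sumℕ-punctured 𝟘 (λs i) ⟩
      (n ∸ 1) * λs i                            ∎
      where
      open ≡-Reasoning
      D : Fin m → Fin n → ℕ
      D j g = if i ≠ᵇ j then multD G (A i) (A j) g else 0
      pairs : ∀ b j → k i * (if b then k j else 0) ≡ sumℕ (λ g → if b then multD G (A i) (A j) g else 0)
      pairs true  j = sym (trans (multD-total (A i) (A j)) (cong₂ _*_ (sizes i) (sizes j)))
      pairs false j = trans (*-zeroʳ (k i)) (sym (sumℕ-zero n))

    sumℕ-otherSizes : sumℕ otherSizes ≡ (m ∸ 1) * sumℕ k
    sumℕ-otherSizes = begin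
      sumℕ (λ i → sumℕ (sizeIfOther i))         ≡⟨ sumℕ-comm sizeIfOther ⟩
      sumℕ (λ j → sumℕ (λ i → sizeIfOther i j)) ≡⟨ sumℕ-cong others ⟩
      sumℕ (λ j → (m ∸ 1) * k j)                ≡⟨ sym (*-distribˡ-sumℕ (m ∸ 1) k) ⟩
      (m ∸ 1) * sumℕ k                          ∎
      where
      open ≡-Reasoning
      others : ∀ j → sumℕ (λ i → sizeIfOther i j) ≡ (m ∸ 1) * k j
      others j = trans (sumℕ-cong (λ i → if-not (i ≡ᵇ j))) (sumℕ-punctured j (k j))

    uniformCode : AMDCode G m
    uniformCode = record
      { A         = A
      ; E         = λ s g → ratio (ind (lookup (A s) g)) (k s)
      ; disjoint  = disjoint
      ; nonempty  = λ s → ∣p∣≥1⇒Nonempty (A s) (subst (1 ≤_) (sym (sizes s)) (k≥1 s))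
      ; E-nonneg  = λ s g → ratio-nonneg _ (k≥1 s)
      ; E-support = λ s g g∉Aₛ →
          trans (cong (λ b → ratio (ind b) (k s)) (∉⇒lookup≡false g∉Aₛ)) (ratio-zero (k≥1 s))
      ; E-sum     = λ s →
          trans (sumℚ-ratio (ind ∘ lookup (A s)) (k≥1 s))
                (trans (cong (λ z → ratio z (k s)) (trans (sym (∣p∣≡sumℕ-ind (A s))) (sizes s)))
                       (ratio-self (k≥1 s)))
      }

    owner-unique : ∀ x i j → lookup (A i) x ≡ true → lookup (A j) x ≡ true → i ≡ j
    owner-unique x i j x∈Aᵢ x∈Aⱼ with i Fin.≟ j
    ... | yes i≡j = i≡j
    ... | no  i≢j = ⊥-elim (disjoint i j i≢j
                      (x , x∈p∩q⁺ (lookup⇒[]= x (A i) x∈Aᵢ , lookup⇒[]= x (A j) x∈Aⱼ)))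

    winningEncodings : ∀ s Δ → Δ ≢ 𝟘 →
                       sumℕ (λ g → ind (lookup (A s) g ∧ wins G uniformCode s g Δ)) ≡ λs s
    winningEncodings s Δ Δ≢𝟘 = begin
      sumℕ (λ g → ind (lookup (A s) g ∧ anyB (other g)))
        ≡⟨ sumℕ-cong (λ g → trans (cong ind (∧-anyB (lookup (A s) g) (other g)))
                                  (ind-anyB (λ j → lookup (A s) g ∧ other g j) (unique g))) ⟩
      sumℕ (λ g → sumℕ (λ j → t j g))
        ≡⟨ sumℕ-comm (λ g j → t j g) ⟩
      sumℕ (λ j → sumℕ (t j))
        ≡⟨ sumℕ-cong (λ j → trans (multD-translate-if (j ≠ᵇ s) (A s) (A j) Δ)
                                  (cong (λ b → if b then multD G (A s) (A j) (⊖ Δ) else 0) (≠ᵇ-sym j s))) ⟩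
      sumℕ (λ j → if s ≠ᵇ j then multD G (A s) (A j) (⊖ Δ) else 0)
        ≡⟨ diffs s (⊖ Δ) ⟩
      (if (⊖ Δ) ≡ᵇ 𝟘 then 0 else λs s)
        ≡⟨ cong (λ b → if b then 0 else λs s) (≡ᵇ-false (Δ≢𝟘 ∘ ⊖≡𝟘⇒≡𝟘)) ⟩
      λs s ∎
      where
      open ≡-Reasoning
      other : Fin n → Fin m → Bool
      other g j = (j ≠ᵇ s) ∧ lookup (A j) (g ⊕ Δ)
      t : Fin m → Fin n → ℕ
      t j g = ind (lookup (A s) g ∧ other g j)
      unique : ∀ g i j → lookup (A s) g ∧ other g i ≡ true → lookup (A s) g ∧ other g j ≡ true → i ≡ j
      unique g i j hitᵢ hitⱼ = owner-unique (g ⊕ Δ) i j (∧∧-true⇒true (lookup (A s) g) (i ≠ᵇ s) _ hitᵢ)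
                                                        (∧∧-true⇒true (lookup (A s) g) (j ≠ᵇ s) _ hitⱼ)

    winProbAt-uniformCode : 2 ≤ n → 1 ≤ m → ∀ Δ → Δ ≢ 𝟘 →
                            winProbAt uniformCode Δ ≡ ratio (sumℕ k * (m ∸ 1)) (m * (n ∸ 1))
    winProbAt-uniformCode n≥2 m≥1 Δ Δ≢𝟘 = begin
      sumℚ (λ s → ratio 1 m ℚ.* sumℚ (λ g → ratio (ind (lookup (A s) g)) (k s) ℚ.* indℚ (win s g)))
        ≡⟨ sumℚ-cong (λ s → cong (ratio 1 m ℚ.*_) (sourceWinProb s)) ⟩
      sumℚ (λ s → ratio 1 m ℚ.* ratio (λs s) (k s))
        ≡⟨ sumℚ-cong (λ s → cong (ratio 1 m ℚ.*_) (ratio-cong (k≥1 s) n∸1≥1 (λ*[n∸1]≡others*k s))) ⟩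
      sumℚ (λ s → ratio 1 m ℚ.* ratio (otherSizes s) (n ∸ 1))
        ≡⟨ sumℚ-cong (λ s → ratio-* 1 (otherSizes s) m≥1 n∸1≥1) ⟩
      sumℚ (λ s → ratio (1 * otherSizes s) (m * (n ∸ 1)))
        ≡⟨ sumℚ-ratio ((1 *_) ∘ otherSizes) (*-mono-≤ m≥1 n∸1≥1) ⟩
      ratio (sumℕ (λ s → 1 * otherSizes s)) (m * (n ∸ 1))
        ≡⟨ cong (λ z → ratio z (m * (n ∸ 1))) total ⟩
      ratio (sumℕ k * (m ∸ 1)) (m * (n ∸ 1)) ∎
      where
      open ≡-Reasoning
      win : Fin m → Fin n → Bool
      win s g = wins G uniformCode s g Δ
      n∸1≥1 : 1 ≤ n ∸ 1
      n∸1≥1 = ∸-monoˡ-≤ 1 n≥2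
      sourceWinProb : ∀ s → sumℚ (λ g → ratio (ind (lookup (A s) g)) (k s) ℚ.* indℚ (win s g))
                            ≡ ratio (λs s) (k s)
      sourceWinProb s =
        trans (sumℚ-cong (λ g → ratio-ind-*-indℚ (lookup (A s) g) (win s g) (k≥1 s)))
              (trans (sumℚ-ratio (λ g → ind (lookup (A s) g ∧ win s g)) (k≥1 s))
                     (cong (λ z → ratio z (k s)) (winningEncodings s Δ Δ≢𝟘)))
      λ*[n∸1]≡others*k : ∀ s → λs s * (n ∸ 1) ≡ otherSizes s * k s
      λ*[n∸1]≡others*k s = trans (*-comm (λs s) _) (trans (sym (size*otherSizes s)) (*-comm (k s) _))
      total : sumℕ (λ s → 1 * otherSizes s) ≡ sumℕ k * (m ∸ 1)
      total = trans (sumℕ-cong (*-identityˡ ∘ otherSizes)) (trans sumℕ-otherSizes (*-comm (m ∸ 1) _))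

mainTheorem8 : (n m : ℕ) → 2 ≤ n → 1 ≤ m → (G : FinAbGroup n)
    → (k λs : Fin m → ℕ) → (∀ i → 1 ≤ k i)
    → Σ (Fin m → Subset n) (λ A → IsGSEDF G m k λs A)
    → Σ (AMDCode G m) (λ C →
         totalEncodings G C ≡ sumℕ k
         × IsMaxWinProb G C (ratio (sumℕ k * (m ∸ 1)) (m * (n ∸ 1))))
mainTheorem8 n m n≥2 m≥1 G k λs k≥1 (A , gsedf) =
  uniformCode ,
  sumℕ-cong (IsGSEDF.sizes gsedf) ,
  constant⇒IsMaxWinProb G uniformCode n≥2 (winProbAt-uniformCode n≥2 m≥1)
  where open UniformCode G k≥1 gsedf
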